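{- Let $m,m_0,p,q$ be positive integers with $m\ge m_0$ and $q>\min\{m_0,p\}$. Then $$\widetilde{F}_v(m;p;m-m_0+q) \le \widetilde{F}_v(m_0;p;q) + m - m_0.$$
   Context: All graphs are finite, simple, undirected. For a graph $G$, $G \overset{v}{\rightarrow} (a_1,\dots,a_s)$ means: for every coloring of $V(G)$ with $s$ colors there is an $i$ such that $G$ contains an $a_i$-clique all of whose vertices have color $i$. For positive integers $m,p$, write $G \overset{v}{\rightarrow} \langle m\rangle_p$ if $G \overset{v}{\rightarrow} (a_1,\dots,a_s)$ for every choice of positive integers $a_1,\dots,a_s$ ($s$ arbitrary) with $\sum_{i=1}^s(a_i-1)+1 = m$ and $\max a_i\le p$. $\widetilde{F}_v(m;p;q)$ is the minimum number of vertices of a graph $G$ with $G \overset{v}{\rightarrow} \langle m\rangle_p$ and clique number $\omega(G)<q$ (it exists iff $q>\min\{m,p\}$). -}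

module Defs where

open import Data.Nat using (ℕ; zero; suc; _+_; _∸_; _≤_; _<_; pred)
open import Data.Nat.Base using (_⊓_)
open import Data.Fin using (Fin)
open import Data.Bool using (Bool; true; false)
open import Data.Vec using (Vec; lookup; map; sum)
open import Data.Product using (Σ; ∃; _×_; _,_)
open import Relation.Binary.PropositionalEquality using (_≡_; _≢_)
open import Relation.Nullary using (¬_)
open import Function.Definitions using (Injective)

record Graph (n : ℕ) : Set where
  field
    adj   : Fin n → Fin n → Bool
    sym   : ∀ u v → adj u v ≡ adj v u
    irrefl : ∀ v → adj v v ≡ false

open Graph public

IsClique : ∀ {n a} → Graph n → (Fin a → Fin n) → Set
IsClique G f = Injective _≡_ _≡_ f × (∀ i j → i ≢ j → adj G (f i) (f j) ≡ true)

HasClique : ∀ {n} → Graph n → ℕ → Set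
HasClique {n} G a = Σ (Fin a → Fin n) λ f → IsClique G f

CliqueNumberBelow : ∀ {n} → Graph n → ℕ → Set
CliqueNumberBelow G q = ¬ HasClique G q

VArrows : ∀ {n s} → Graph n → Vec ℕ s → Set
VArrows {n} {s} G as =
  (c : Fin n → Fin s) →
  ∃ λ (i : Fin s) → Σ (Fin (lookup as i) → Fin n) λ f →
    IsClique G f × (∀ k → c (f k) ≡ i)

VArrowsBracket : ∀ {n} → Graph n → ℕ → ℕ → Set
VArrowsBracket G m p =
  ∀ (s : ℕ) → 1 ≤ s → (as : Vec ℕ s) →
  (∀ i → 1 ≤ lookup as i) →
  (∀ i → lookup as i ≤ p) →
  sum (map pred as) + 1 ≡ m →
  VArrows G as

Good : ℕ → ℕ → ℕ → ℕ → Set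
Good m p q n = Σ (Graph n) λ G → VArrowsBracket G m p × CliqueNumberBelow G q

IsFv : ℕ → ℕ → ℕ → ℕ → Set
IsFv m p q N = Good m p q N × (∀ n → Good m p q n → N ≤ n)

-- Adjoining an apex (a vertex adjacent to all others) raises the clique number by one and turns
-- G →v ⟨m⟩_p into cone G →v ⟨m+1⟩_p: given a colouring of the cone, lower by one the target of
-- the apex's colour (a target 1 is met by the apex alone), find a monochromatic clique in G,
-- and add the apex to it if the colours agree. Iterating m − m₀ times maps a witness for
-- F̃_v(m₀;p;q) to a witness for F̃_v(m;p;m−m₀+q) with m − m₀ more vertices.
module Submission where

open import Defs hiding (sym)
open import Data.Nat using (ℕ; zero; suc; _+_; _∸_; _≤_; _<_; _⊓_; pred; z≤n; s≤s; >-nonZero)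
open import Data.Nat.Properties using (+-suc; +-comm; m∸n+n≡m; pred-mono-≤; pred[n]≤n; ≤-trans; suc-pred)
open import Data.Fin using (Fin; punchIn; punchOut; _≟_)
  renaming (zero to apex; suc to ↑_)
open import Data.Fin.Properties using (suc-injective; any?; punchIn-injective; punchInᵢ≢i; punchIn-punchOut)
open import Data.Bool using (Bool; true; false)
open import Data.Vec using (Vec; _∷_; lookup; map; sum; updateAt)
open import Data.Vec.Properties using (lookup∘updateAt; lookup∘updateAt′; lookup-map; map-updateAt)
open import Data.Product using (Σ; _×_; _,_)
open import Function using (_∘_)
open import Function.Definitions using (Injective)
open import Relation.Nullary using (yes; no; contradiction)
open import Relation.Binary.PropositionalEquality
  using (_≡_; _≢_; refl; sym; trans; cong; subst; subst₂; module ≡-Reasoning)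

private
  variable
    n s : ℕ

IsClique-∘ : ∀ {a b} {G : Graph n} {f : Fin a → Fin n} {g : Fin b → Fin a} →
             IsClique G f → Injective _≡_ _≡_ g → IsClique G (f ∘ g)
IsClique-∘ (f-inj , f-adj) g-inj = (λ e → g-inj (f-inj e)) , λ i j i≢j → f-adj _ _ (i≢j ∘ g-inj)

MonoClique : Graph n → (Fin n → Fin s) → Fin s → ℕ → Set
MonoClique {n} G c i a = Σ (Fin a → Fin n) λ f → IsClique G f × (∀ k → c (f k) ≡ i)

mono-empty : ∀ {G : Graph n} {c : Fin n → Fin s} {i} → MonoClique G c i 0
mono-empty = (λ ()) , ((λ { {()} }) , λ ()) , λ ()

Admissible : ℕ → ℕ → Vec ℕ s → Set
Admissible m p as =
  (∀ i → 1 ≤ lookup as i) × (∀ i → lookup as i ≤ p) × sum (map pred as) + 1 ≡ m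

sum-updateAt-pred : (xs : Vec ℕ s) (i : Fin s) → 1 ≤ lookup xs i →
                    suc (sum (updateAt xs i pred)) ≡ sum xs
sum-updateAt-pred (zero  ∷ xs) apex  ()
sum-updateAt-pred (suc x ∷ xs) apex  _   = refl
sum-updateAt-pred (x ∷ xs)     (↑ i) 1≤xᵢ =
  trans (sym (+-suc x _)) (cong (x +_) (sum-updateAt-pred xs i 1≤xᵢ))

Admissible-updateAt-pred : ∀ {m p} (as : Vec ℕ s) (i : Fin s) → 2 ≤ lookup as i →
                           Admissible (suc m) p as → Admissible m p (updateAt as i pred)
Admissible-updateAt-pred {p = p} as i 2≤aᵢ (1≤as , as≤p , weight) =
  lower-bound , upper-bound , cong pred (trans decreased weight)
  where
  open ≡-Reasoning
  lower-bound : ∀ j → 1 ≤ lookup (updateAt as i pred) j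
  lower-bound j with j ≟ i
  ... | yes refl = subst (1 ≤_) (sym (lookup∘updateAt j as)) (pred-mono-≤ 2≤aᵢ)
  ... | no j≢i   = subst (1 ≤_) (sym (lookup∘updateAt′ j i j≢i as)) (1≤as j)
  upper-bound : ∀ j → lookup (updateAt as i pred) j ≤ p
  upper-bound j with j ≟ i
  ... | yes refl = subst (_≤ p) (sym (lookup∘updateAt j as)) (≤-trans pred[n]≤n (as≤p j))
  ... | no j≢i   = subst (_≤ p) (sym (lookup∘updateAt′ j i j≢i as)) (as≤p j)
  decreased : suc (sum (map pred (updateAt as i pred))) + 1 ≡ sum (map pred as) + 1
  decreased = cong (_+ 1) (begin
    suc (sum (map pred (updateAt as i pred)))   ≡⟨ cong (suc ∘ sum) (map-updateAt as i refl) ⟩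
    suc (sum (updateAt (map pred as) i pred))   ≡⟨ sum-updateAt-pred (map pred as) i 1≤pred-aᵢ ⟩
    sum (map pred as)                           ∎)
    where
    1≤pred-aᵢ : 1 ≤ lookup (map pred as) i
    1≤pred-aᵢ = subst (1 ≤_) (sym (lookup-map i pred as)) (pred-mono-≤ 2≤aᵢ)

VArrowsBracket⇒VArrows : ∀ {G : Graph n} {m p} → VArrowsBracket G m p →
                         1 ≤ s → (as : Vec ℕ s) → Admissible m p as → VArrows G as
VArrowsBracket⇒VArrows arrows 1≤s as (1≤as , as≤p , weight) = arrows _ 1≤s as 1≤as as≤p weight

module _ (G : Graph n) where

  cone-adj : Fin (suc n) → Fin (suc n) → Bool
  cone-adj apex  apex  = false
  cone-adj apex  (↑ _) = true
  cone-adj (↑ _) apex  = true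
  cone-adj (↑ u) (↑ v) = adj G u v

  cone-sym : ∀ u v → cone-adj u v ≡ cone-adj v u
  cone-sym apex  apex  = refl
  cone-sym apex  (↑ _) = refl
  cone-sym (↑ _) apex  = refl
  cone-sym (↑ u) (↑ v) = Graph.sym G u v

  cone-irrefl : ∀ v → cone-adj v v ≡ false
  cone-irrefl apex  = refl
  cone-irrefl (↑ v) = irrefl G v

  cone : Graph (suc n)
  cone = record { adj = cone-adj ; sym = cone-sym ; irrefl = cone-irrefl }

  HasClique-avoiding-apex : ∀ {a} {f : Fin a → Fin (suc n)} → IsClique cone f →
                            (∀ i → f i ≢ apex) → HasClique G a
  HasClique-avoiding-apex {a} {f} (f-inj , f-adj) avoids = g , g-inj , g-adj
    where
    open ≡-Reasoning
    g : Fin a → Fin n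
    g i = punchOut (avoids i ∘ sym)
    ↑g≡f : ∀ i → ↑ g i ≡ f i
    ↑g≡f i = punchIn-punchOut (avoids i ∘ sym)
    g-inj : Injective _≡_ _≡_ g
    g-inj {i} {j} gᵢ≡gⱼ = f-inj (begin
      f i     ≡⟨ sym (↑g≡f i) ⟩
      ↑ g i   ≡⟨ cong ↑_ gᵢ≡gⱼ ⟩
      ↑ g j   ≡⟨ ↑g≡f j ⟩
      f j     ∎)
    g-adj : ∀ i j → i ≢ j → adj G (g i) (g j) ≡ true
    g-adj i j i≢j =
      subst₂ (λ u v → cone-adj u v ≡ true) (sym (↑g≡f i)) (sym (↑g≡f j)) (f-adj i j i≢j)

  -- Dropping the apex, or any vertex if the apex is not used, leaves a q-clique of G.
  cone-CliqueNumberBelow : ∀ {q} → CliqueNumberBelow G q → CliqueNumberBelow cone (suc q)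
  cone-CliqueNumberBelow ω<q (f , f-clique@(f-inj , _)) with any? (λ j → f j ≟ apex)
  ... | yes (j , fⱼ≡apex) =
    ω<q (drop j λ i fᵢ≡apex → punchInᵢ≢i j i (f-inj (trans fᵢ≡apex (sym fⱼ≡apex))))
    where
    drop : ∀ j → (∀ i → f (punchIn j i) ≢ apex) → HasClique G _
    drop j = HasClique-avoiding-apex (IsClique-∘ {G = cone} f-clique (punchIn-injective j _ _))
  ... | no no-apex =
    ω<q (HasClique-avoiding-apex (IsClique-∘ {G = cone} f-clique suc-injective)
           λ i fᵢ≡apex → no-apex (↑ i , fᵢ≡apex))

  MonoClique-lift : ∀ (c : Fin (suc n) → Fin s) {i a} →
                    MonoClique G (c ∘ ↑_) i a → MonoClique cone c i a
  MonoClique-lift c (f , (f-inj , f-adj) , f-colour) =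
    ↑_ ∘ f , (f-inj ∘ suc-injective , f-adj) , f-colour

  MonoClique-add-apex : ∀ (c : Fin (suc n) → Fin s) {i a} →
                        MonoClique G (c ∘ ↑_) i a → c apex ≡ i → MonoClique cone c i (suc a)
  MonoClique-add-apex c {i} {a} (f , (f-inj , f-adj) , f-colour) apex-colour =
    f⁺ , (f⁺-inj , f⁺-adj) , f⁺-colour
    where
    f⁺ : Fin (suc a) → Fin (suc n)
    f⁺ apex  = apex
    f⁺ (↑ k) = ↑ f k
    f⁺-inj : Injective _≡_ _≡_ f⁺
    f⁺-inj {apex}  {apex}  _ = refl
    f⁺-inj {↑ _}   {↑ _}   e = cong ↑_ (f-inj (suc-injective e))
    f⁺-adj : ∀ k l → k ≢ l → cone-adj (f⁺ k) (f⁺ l) ≡ true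
    f⁺-adj apex  apex  k≢l = contradiction refl k≢l
    f⁺-adj apex  (↑ _) _   = refl
    f⁺-adj (↑ _) apex  _   = refl
    f⁺-adj (↑ k) (↑ l) k≢l = f-adj k l (k≢l ∘ cong ↑_)
    f⁺-colour : ∀ k → c (f⁺ k) ≡ i
    f⁺-colour apex  = apex-colour
    f⁺-colour (↑ k) = f-colour k

  -- The colour of the apex had its target lowered by one; adding the apex restores it.
  MonoClique-from-lowered : ∀ {as : Vec ℕ s} (c : Fin (suc n) → Fin s) → 1 ≤ lookup as (c apex) →
    ∀ j → MonoClique G (c ∘ ↑_) j (lookup (updateAt as (c apex) pred) j) →
    MonoClique cone c j (lookup as j)
  MonoClique-from-lowered {as = as} c 1≤a j mono with j ≟ c apex
  ... | yes refl =
    subst (MonoClique cone c j) (suc-pred _ {{>-nonZero 1≤a}})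
      (MonoClique-add-apex c (subst (MonoClique G (c ∘ ↑_) j) (lookup∘updateAt j as) mono) refl)
  ... | no j≢apex-colour =
    MonoClique-lift c
      (subst (MonoClique G (c ∘ ↑_) j) (lookup∘updateAt′ j (c apex) j≢apex-colour as) mono)

  cone-VArrowsBracket : ∀ {m p} → VArrowsBracket G m p → VArrowsBracket cone (suc m) p
  cone-VArrowsBracket arrows s 1≤s as 1≤as as≤p weight c with lookup as (c apex) in a≡
  ... | zero = contradiction (subst (1 ≤_) a≡ (1≤as (c apex))) λ ()
  ... | suc zero =
    c apex , subst (MonoClique cone c (c apex)) (sym a≡)
                   (MonoClique-add-apex c (mono-empty {G = G} {c = c ∘ ↑_}) refl)
  ... | suc (suc _) =
    let j , mono = VArrowsBracket⇒VArrows {G = G} arrows 1≤s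
                     (updateAt as (c apex) pred) lowered-admissible (c ∘ ↑_)
    in j , MonoClique-from-lowered {as = as} c (1≤as (c apex)) j mono
    where
    2≤a : 2 ≤ lookup as (c apex)
    2≤a = subst (2 ≤_) (sym a≡) (s≤s (s≤s z≤n))
    lowered-admissible : Admissible _ _ (updateAt as (c apex) pred)
    lowered-admissible = Admissible-updateAt-pred as (c apex) 2≤a (1≤as , as≤p , weight)

Good-cone : ∀ {m p q} → Good m p q n → Good (suc m) p (suc q) (suc n)
Good-cone (G , arrows , ω<q) =
  cone G , cone-VArrowsBracket G arrows , cone-CliqueNumberBelow G ω<q

Good-+ : ∀ k {m p q} → Good m p q n → Good (k + m) p (k + q) (k + n)
Good-+ zero    good = good
Good-+ (suc k) good = Good-cone (Good-+ k good)

theorem11 : (m m₀ p q : ℕ) → 1 ≤ m → 1 ≤ m₀ → 1 ≤ p → 1 ≤ q →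
    m₀ ≤ m → m₀ ⊓ p < q →
    (A B : ℕ) → IsFv m p (m ∸ m₀ + q) A → IsFv m₀ p q B →
    A ≤ B + (m ∸ m₀)
theorem11 m m₀ p q _ _ _ _ m₀≤m _ A B (_ , A-minimal) (B-good , _) =
  subst (A ≤_) (+-comm (m ∸ m₀) B) (A-minimal (m ∸ m₀ + B) coned)
  where
  coned : Good m p (m ∸ m₀ + q) (m ∸ m₀ + B)
  coned = subst (λ m′ → Good m′ p (m ∸ m₀ + q) (m ∸ m₀ + B)) (m∸n+n≡m m₀≤m)
                (Good-+ (m ∸ m₀) B-good)
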